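{- The class of associative posets is not axiomatizable by first-order sentences in the signature $\{\leq\}$.
   Context: A binary operation $\cdot$ on a poset $(P,\leq)$ is admissible if for all $x,y\in P$: $x\leq y\iff x\cdot y=x$. A right-regular band (RRB) is a set with an associative binary operation satisfying $x\cdot x=x$ and $x\cdot y\cdot x=y\cdot x$. A poset is associative if it admits an admissible RRB operation. -}

module Defs where

open import Level using (0ℓ)
open import Data.Nat using (ℕ; suc)
open import Data.Fin using (Fin; zero; suc)
open import Data.Product using (Σ; _×_; _,_)
open import Data.Empty using (⊥)
open import Relation.Nullary using (¬_; Dec)
open import Relation.Binary using (Rel; Decidable; DecidableEquality; IsPartialOrder)
open import Relation.Binary.PropositionalEquality using (_≡_)

-- First-order logic with equality in the signature {≤}
-- (formulas with de Bruijn variables; n = number of free variables)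

infixr 5 _⇒_
infixr 6 _∨′_
infixr 7 _∧′_
data Formula : ℕ → Set where
  _≤′_ : ∀ {n} → Fin n → Fin n → Formula n
  _≐_  : ∀ {n} → Fin n → Fin n → Formula n
  ⊥′   : ∀ {n} → Formula n
  _⇒_  : ∀ {n} → Formula n → Formula n → Formula n
  _∧′_ : ∀ {n} → Formula n → Formula n → Formula n
  _∨′_ : ∀ {n} → Formula n → Formula n → Formula n
  ∀′   : ∀ {n} → Formula (suc n) → Formula n
  ∃′   : ∀ {n} → Formula (suc n) → Formula n

Sentence : Set
Sentence = Formula 0

-- To obtain the usual two-valued (classical) Tarskian
-- semantics in Agda's constructive metatheory, the interpretation of
-- ≤ and of equality on the carrier are required to be decidable, and
-- ∨ / ∃ are interpreted classically (¬(¬A × ¬B), ¬ ∀ ¬).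

record Structure : Set₁ where
  field
    Carrier : Set
    _≤_     : Rel Carrier 0ℓ
    _≟_     : DecidableEquality Carrier
    _≤?_    : Decidable _≤_

open Structure public

extend : ∀ {n} {A : Set} → A → (Fin n → A) → Fin (suc n) → A
extend a ρ zero    = a
extend a ρ (suc i) = ρ i

Sat : (M : Structure) → ∀ {n} → (Fin n → Carrier M) → Formula n → Set
Sat M ρ (i ≤′ j) = _≤_ M (ρ i) (ρ j)
Sat M ρ (i ≐ j)  = ρ i ≡ ρ j
Sat M ρ ⊥′       = ⊥
Sat M ρ (φ ⇒ ψ)  = Sat M ρ φ → Sat M ρ ψ
Sat M ρ (φ ∧′ ψ) = Sat M ρ φ × Sat M ρ ψ
Sat M ρ (φ ∨′ ψ) = ¬ (¬ Sat M ρ φ × ¬ Sat M ρ ψ)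
Sat M ρ (∀′ φ)   = (a : Carrier M) → Sat M (extend a ρ) φ
Sat M ρ (∃′ φ)   = ¬ ((a : Carrier M) → ¬ Sat M (extend a ρ) φ)

noVars : {A : Set} → Fin 0 → A
noVars ()

_⊨_ : Structure → Sentence → Set
M ⊨ σ = Sat M noVars σ

_⊨ₜ_ : Structure → (Sentence → Set) → Set
M ⊨ₜ T = ∀ σ → T σ → M ⊨ σ

Axiomatizable : (Structure → Set) → Set₁
Axiomatizable K = Σ (Sentence → Set) λ T → ∀ M → (K M → M ⊨ₜ T) × (M ⊨ₜ T → K M)

IsPoset : Structure → Set
IsPoset M = IsPartialOrder (_≡_ {A = Carrier M}) (_≤_ M)

Admissible : (M : Structure) → (Carrier M → Carrier M → Carrier M) → Set
Admissible M _·_ = ∀ x y → (_≤_ M x y → (x · y) ≡ x) × ((x · y) ≡ x → _≤_ M x y)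

IsRRB : (A : Set) → (A → A → A) → Set
IsRRB A _·_ =
  (∀ x y z → ((x · y) · z) ≡ (x · (y · z))) ×
  (∀ x → (x · x) ≡ x) ×
  (∀ x y → ((x · y) · x) ≡ (y · x))

IsAssociativePoset : Structure → Set
IsAssociativePoset M =
  IsPoset M × Σ (Carrier M → Carrier M → Carrier M) λ op → IsRRB (Carrier M) op × Admissible M op

-- M = ℤ ⊕ ℤ is associative: identifying the two copies of ℤ, x · y is min(x, y) placed in the
-- component of y.  N = ℤ ⊕ (ℤ × ℤ), with ℤ × ℤ ordered lexicographically, is not: for a in the
-- first and b in the second component, u = a · b and v = b · a satisfy v · u = u, so x ↦ x · v
-- embeds the down-set of u into that of v.  But ↓u contains an infinite ascending chain inside one
-- copy of ℤ, whereas ↓v is a down-set of ℤ with a maximum.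
--
-- Yet M and N satisfy the same sentences (Ehrenfeucht–Fraïssé).  In a lexicographic sum of copies
-- of ℤ, take the displacement from a to b to be b − a when they lie in the same copy and ±∞
-- otherwise.  Tuples whose pairwise displacements agree up to 2^k (equal, or both ≥ 2^k, or both
-- ≤ −2^k) satisfy the same formulas of quantifier rank k: a new point within 2^(k−1) of an old one
-- is answered at the same offset from that point's partner; any other point 2^(k−1) above the
-- partner of its greatest old predecessor, or, if it has none, 2^(k−1) below the partner of the
-- least old point.
module Submission where

open import Defs hiding (Carrier; _≤_; _≟_; _≤?_)
open Structure using () renaming (Carrier to ∣_∣; _≤_ to _⊢_≤_)
open import Level using (0ℓ)
open import Function using (_⇔_; mk⇔; Equivalence; _∘_; id; flip)
import Function.Properties.Equivalence as ⇔
open import Function.Related.TypeIsomorphisms using (→-cong-⇔; ¬-cong-⇔)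
open import Data.Empty using (⊥; ⊥-elim)
open import Data.Unit using (⊤; tt)
open import Data.Product as Product using (∃; _×_; _,_; proj₁; proj₂)
open import Data.Product.Function.NonDependent.Propositional using (_×-⇔_)
open import Data.Product.Relation.Binary.Lex.Strict using (×-Lex)
open import Data.Sum as Sum using (_⊎_; inj₁; inj₂; reduce)
open import Data.Sum.Properties using (≡-dec; inj₁-injective; inj₂-injective; swap-involutive)
open import Data.Sum.Relation.Binary.Pointwise
  using (Pointwise; inj₁; inj₂; ⊎-decidable; ⊎-refl; ⊎-transitive; ⊎-antisymmetric; Pointwise-≡⇒≡)
open import Data.Nat as ℕ using (ℕ; zero; suc; _⊔_; s≤s)
import Data.Nat.Properties as ℕₚ
open import Data.Fin using (Fin; zero; suc)
open import Data.Integer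
  using (ℤ; +_; -[1+_]; +[1+_]; 0ℤ; 1ℤ; pred; -_; _+_; _-_; _≤_; _<_; +≤+; +<+) renaming (∣_∣ to ∣_∣ℤ)
open import Data.Integer.Properties
  using ( _≟_; _≤?_; _<?_; ≤-refl; ≤-reflexive; ≤-trans; ≤-total; <-irrefl; <⇒≤; <⇒≱; ≮⇒≥; ≰⇒>
        ; ≤-<-trans; <-≤-trans; module ≤-Reasoning; ≤-isTotalOrder
        ; +-identityˡ; +-identityʳ; +-inverseʳ; +-monoˡ-≤; +-monoʳ-≤; +-mono-≤; +-monoˡ-<; +-mono-≤-<
        ; neg-involutive; neg-distrib-+; neg-mono-≤; neg-mono-<; pos-+; i≤j+i
        ; i≤j⇒0≤j-i; 0≤i-j⇒j≤i; i-j≡0⇒i≡j; 0≤i⇒+∣i∣≡i; suc[i]≤j⇒i<j; i<j⇒suc[i]≤j; i≤pred[j]⇒i<j )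
open import Data.Integer.Tactic.RingSolver using (solve-∀)
open import Data.List using (List; []; _∷_)
open import Data.List.Membership.Propositional using (_∈_; find; lose)
open import Data.List.Relation.Unary.Any using (here; there; any?)
open import Data.List.Relation.Unary.All using (All; []; _∷_; lookup)
open import Relation.Nullary using (¬_; Dec; yes; no)
open import Relation.Nullary.Decidable using (_×-dec_; map′; ¬?; decidable-stable)
open import Relation.Binary using (Rel; Decidable; DecidableEquality; IsPartialOrder; IsTotalOrder; TotalOrder)
import Relation.Binary.PropositionalEquality as ≡
open import Relation.Binary.PropositionalEquality
  using (_≡_; refl; sym; trans; cong; cong₂; subst; subst₂; module ≡-Reasoning)
import Algebra.Construct.NaturalChoice.Min as NaturalMin

-- First-order transfer

qr : ∀ {n} → Formula n → ℕ
qr (_ ≤′ _) = 0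
qr (_ ≐ _)  = 0
qr ⊥′       = 0
qr (φ ⇒ ψ)  = qr φ ⊔ qr ψ
qr (φ ∧′ ψ) = qr φ ⊔ qr ψ
qr (φ ∨′ ψ) = qr φ ⊔ qr ψ
qr (∀′ φ)   = suc (qr φ)
qr (∃′ φ)   = suc (qr φ)

⊔≤ˡ : ∀ {m n o} → m ⊔ n ℕ.≤ o → m ℕ.≤ o
⊔≤ˡ = ℕₚ.m⊔n≤o⇒m≤o _ _

⊔≤ʳ : ∀ {m n o} → m ⊔ n ℕ.≤ o → n ℕ.≤ o
⊔≤ʳ = ℕₚ.m⊔n≤o⇒n≤o _ _

record BackAndForth (A B : Structure) : Set₁ where
  field
    Related  : ℕ → ∀ {n} → (Fin n → ∣ A ∣) → (Fin n → ∣ B ∣) → Set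
    atomic-≤ : ∀ {k n ρ σ} → Related k {n} ρ σ → ∀ i j → A ⊢ ρ i ≤ ρ j ⇔ B ⊢ σ i ≤ σ j
    atomic-≡ : ∀ {k n ρ σ} → Related k {n} ρ σ → ∀ i j → ρ i ≡ ρ j ⇔ σ i ≡ σ j
    forth    : ∀ {k n ρ σ} → Related (suc k) {n} ρ σ → ∀ a → ∃ λ b → Related k (extend a ρ) (extend b σ)
    back     : ∀ {k n ρ σ} → Related (suc k) {n} ρ σ → ∀ b → ∃ λ a → Related k (extend a ρ) (extend b σ)
    start    : ∀ k → Related k noVars noVars

module _ {A B : Structure} (G : BackAndForth A B) where
  open BackAndForth G
  open Equivalence

  ∀-transfer : ∀ {k n ρ σ} {P : ∣ A ∣ → Set} {Q : ∣ B ∣ → Set} → Related (suc k) {n} ρ σ →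
               (∀ {a b} → Related k (extend a ρ) (extend b σ) → P a ⇔ Q b) → (∀ a → P a) ⇔ (∀ b → Q b)
  ∀-transfer R P⇔Q = mk⇔
    (λ ∀P b → let a , R′ = back R b in to (P⇔Q R′) (∀P a))
    (λ ∀Q a → let b , R′ = forth R a in from (P⇔Q R′) (∀Q b))

  Sat-transfer : ∀ {k n} (φ : Formula n) → qr φ ℕ.≤ k → ∀ {ρ σ} → Related k ρ σ → Sat A ρ φ ⇔ Sat B σ φ
  Sat-transfer (i ≤′ j) _ R = atomic-≤ R i j
  Sat-transfer (i ≐ j)  _ R = atomic-≡ R i j
  Sat-transfer ⊥′       _ _ = ⇔.refl
  Sat-transfer (φ ⇒ ψ)  q R = →-cong-⇔ (Sat-transfer φ (⊔≤ˡ q) R) (Sat-transfer ψ (⊔≤ʳ q) R)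
  Sat-transfer (φ ∧′ ψ) q R = Sat-transfer φ (⊔≤ˡ q) R ×-⇔ Sat-transfer ψ (⊔≤ʳ q) R
  Sat-transfer (φ ∨′ ψ) q R =
    ¬-cong-⇔ (¬-cong-⇔ (Sat-transfer φ (⊔≤ˡ q) R) ×-⇔ ¬-cong-⇔ (Sat-transfer ψ (⊔≤ʳ q) R))
  Sat-transfer (∀′ φ) (s≤s q) R = ∀-transfer R (Sat-transfer φ q)
  Sat-transfer (∃′ φ) (s≤s q) R = ¬-cong-⇔ (∀-transfer R (¬-cong-⇔ ∘ Sat-transfer φ q))

  ⊨-transfer : ∀ φ → A ⊨ φ → B ⊨ φ
  ⊨-transfer φ = to (Sat-transfer φ ℕₚ.≤-refl (start (qr φ)))

⊨-transfer⇒¬Axiomatizable : ∀ {K A B} → K A → ¬ K B → (∀ φ → A ⊨ φ → B ⊨ φ) → ¬ Axiomatizable K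
⊨-transfer⇒¬Axiomatizable {A = A} {B} KA ¬KB transfer (_ , axiomatizes) =
  ¬KB (proj₂ (axiomatizes B) λ φ Tφ → transfer φ (proj₁ (axiomatizes A) KA φ Tφ))

-- Associative posets

infixr 5 _⊕_
_⊕_ : Structure → Structure → Structure
A ⊕ B = record
  { Carrier = ∣ A ∣ ⊎ ∣ B ∣
  ; _≤_     = Pointwise (_⊢_≤_ A) (_⊢_≤_ B)
  ; _≟_     = ≡-dec (Structure._≟_ A) (Structure._≟_ B)
  ; _≤?_    = ⊎-decidable (Structure._≤?_ A) (Structure._≤?_ B)
  }

⊕-isPoset : ∀ {A B} → IsPoset A → IsPoset B → IsPoset (A ⊕ B)
⊕-isPoset A-poset B-poset = record
  { isPreorder = record
    { isEquivalence = ≡.isEquivalence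
    ; reflexive     = λ { refl → ⊎-refl (A.reflexive refl) (B.reflexive refl) }
    ; trans         = ⊎-transitive A.trans B.trans
    }
  ; antisym = λ x≤y y≤x → Pointwise-≡⇒≡ (⊎-antisymmetric A.antisym B.antisym x≤y y≤x)
  }
  where
  module A = IsPartialOrder A-poset
  module B = IsPartialOrder B-poset

module _ {A B C D : Set} {R : A → C → Set} {S : B → D → Set} where
  Pointwise-inj₁ʳ : ∀ {x c} → Pointwise R S x (inj₁ c) → ∃ λ a → x ≡ inj₁ a × R a c
  Pointwise-inj₁ʳ (inj₁ a∼c) = _ , refl , a∼c

  Pointwise-inj₂ʳ : ∀ {x d} → Pointwise R S x (inj₂ d) → ∃ λ b → x ≡ inj₂ b × S b d
  Pointwise-inj₂ʳ (inj₂ b∼d) = _ , refl , b∼d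

module _ (C : Structure) (C-total : IsTotalOrder _≡_ (_⊢_≤_ C)) where
  private
    C-order : TotalOrder 0ℓ 0ℓ 0ℓ
    C-order = record { isTotalOrder = C-total }

    open NaturalMin C-order

    infixl 7 _·_
    _·_ : ∣ C ⊕ C ∣ → ∣ C ⊕ C ∣ → ∣ C ⊕ C ∣
    x · y = Sum.map (reduce x ⊓_) (reduce x ⊓_) y

    reduce-· : ∀ x y → reduce (x · y) ≡ reduce x ⊓ reduce y
    reduce-· x (inj₁ _) = refl
    reduce-· x (inj₂ _) = refl

    ·-assoc : ∀ x y z → (x · y) · z ≡ x · (y · z)
    ·-assoc x y (inj₁ c) = cong inj₁ (trans (cong (_⊓ c) (reduce-· x y)) (⊓-assoc (reduce x) (reduce y) c))
    ·-assoc x y (inj₂ c) = cong inj₂ (trans (cong (_⊓ c) (reduce-· x y)) (⊓-assoc (reduce x) (reduce y) c))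

    ·-idem : ∀ x → x · x ≡ x
    ·-idem (inj₁ a) = cong inj₁ (⊓-idem a)
    ·-idem (inj₂ a) = cong inj₂ (⊓-idem a)

    a⊓b⊓a≡b⊓a : ∀ a b → (a ⊓ b) ⊓ a ≡ b ⊓ a
    a⊓b⊓a≡b⊓a a b = trans (cong (_⊓ a) (⊓-comm a b)) (trans (⊓-assoc b a a) (cong (b ⊓_) (⊓-idem a)))

    x·y·x≡y·x : ∀ x y → (x · y) · x ≡ y · x
    x·y·x≡y·x (inj₁ a) y = cong inj₁ (trans (cong (_⊓ a) (reduce-· (inj₁ a) y)) (a⊓b⊓a≡b⊓a a (reduce y)))
    x·y·x≡y·x (inj₂ a) y = cong inj₂ (trans (cong (_⊓ a) (reduce-· (inj₂ a) y)) (a⊓b⊓a≡b⊓a a (reduce y)))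

    ·-admissible : Admissible (C ⊕ C) _·_
    ·-admissible (inj₁ a) (inj₁ b) =
      (λ { (inj₁ a≤b) → cong inj₁ (x≤y⇒x⊓y≈x a≤b) }) , λ a⊓b≡a → inj₁ (x⊓y≈x⇒x≤y (inj₁-injective a⊓b≡a))
    ·-admissible (inj₁ _) (inj₂ _) = (λ ()) , (λ ())
    ·-admissible (inj₂ _) (inj₁ _) = (λ ()) , (λ ())
    ·-admissible (inj₂ a) (inj₂ b) =
      (λ { (inj₂ a≤b) → cong inj₂ (x≤y⇒x⊓y≈x a≤b) }) , λ a⊓b≡a → inj₂ (x⊓y≈x⇒x≤y (inj₂-injective a⊓b≡a))

  ⊕-self-isAssociativePoset : IsAssociativePoset (C ⊕ C)
  ⊕-self-isAssociativePoset =
    ⊕-isPoset {C} {C} isPartialOrder isPartialOrder , _·_ , (·-assoc , ·-idem , x·y·x≡y·x) , ·-admissible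
    where open IsTotalOrder C-total using (isPartialOrder)

module AdmissibleRRB (M : Structure) (_·_ : ∣ M ∣ → ∣ M ∣ → ∣ M ∣)
                     (rrb : IsRRB ∣ M ∣ _·_) (adm : Admissible M _·_) where
  private
    _≤ₘ_ : ∣ M ∣ → ∣ M ∣ → Set
    _≤ₘ_ = _⊢_≤_ M

    ·-assoc : ∀ x y z → (x · y) · z ≡ x · (y · z)
    ·-assoc = proj₁ rrb

    ·-idem : ∀ x → x · x ≡ x
    ·-idem = proj₁ (proj₂ rrb)

    x·y·x≡y·x : ∀ x y → (x · y) · x ≡ y · x
    x·y·x≡y·x = proj₂ (proj₂ rrb)

    ≤⇒· : ∀ {x y} → x ≤ₘ y → x · y ≡ x
    ≤⇒· = proj₁ (adm _ _)

    ·⇒≤ : ∀ {x y} → x · y ≡ x → x ≤ₘ y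
    ·⇒≤ = proj₂ (adm _ _)

  open ≡-Reasoning

  x·y≤y : ∀ x y → (x · y) ≤ₘ y
  x·y≤y x y = ·⇒≤ (trans (·-assoc x y y) (cong (x ·_) (·-idem y)))

  ·-monoˡ-≤ : ∀ {x y} z → x ≤ₘ y → (x · z) ≤ₘ (y · z)
  ·-monoˡ-≤ {x} {y} z x≤y = ·⇒≤ (begin
    (x · z) · (y · z) ≡⟨ ·-assoc x z (y · z) ⟩
    x · (z · (y · z)) ≡⟨ cong (x ·_) (sym (·-assoc z y z)) ⟩
    x · ((z · y) · z) ≡⟨ cong (x ·_) (x·y·x≡y·x z y) ⟩
    x · (y · z)       ≡⟨ sym (·-assoc x y z) ⟩
    (x · y) · z       ≡⟨ cong (_· z) (≤⇒· x≤y) ⟩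
    x · z             ∎)

  y·x·x·y≡x·y : ∀ x y → (y · x) · (x · y) ≡ x · y
  y·x·x·y≡x·y x y = begin
    (y · x) · (x · y) ≡⟨ sym (·-assoc (y · x) x y) ⟩
    ((y · x) · x) · y ≡⟨ cong (_· y) (trans (·-assoc y x x) (cong (y ·_) (·-idem x))) ⟩
    (y · x) · y       ≡⟨ x·y·x≡y·x y x ⟩
    x · y             ∎

  ·-retract : ∀ {u v x} → v · u ≡ u → x ≤ₘ u → (x · v) · u ≡ x
  ·-retract {u} {v} {x} v·u≡u x≤u = trans (·-assoc x v u) (trans (cong (x ·_) v·u≡u) (≤⇒· x≤u))

  ·-reflects-≤ : ∀ {u v x x'} → v · u ≡ u → x ≤ₘ u → x' ≤ₘ u → (x · v) ≤ₘ (x' · v) → x ≤ₘ x'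
  ·-reflects-≤ {u} v·u≡u x≤u x'≤u xv≤x'v =
    subst₂ _≤ₘ_ (·-retract v·u≡u x≤u) (·-retract v·u≡u x'≤u) (·-monoˡ-≤ u xv≤x'v)

no-bounded-increasing : ∀ (f : ℕ → ℤ) → (∀ j → f j < f (suc j)) → ∀ c → ¬ (∀ j → f j ≤ c)
no-bounded-increasing f increasing c bounded = <-irrefl refl (suc[i]≤j⇒i<j (begin
  1ℤ + c                   ≡⟨ add-sub (f 0) c ⟩
  f 0 + (1ℤ + (c - f 0))   ≡⟨ cong (λ z → f 0 + (1ℤ + z)) (sym +n≡c-f0) ⟩
  f 0 + + suc n            ≤⟨ growth (suc n) ⟩
  f (suc n)                ≤⟨ bounded (suc n) ⟩
  c                        ∎))
  where
  open ≤-Reasoning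
  n : ℕ
  n = ∣ c - f 0 ∣ℤ
  +n≡c-f0 : + n ≡ c - f 0
  +n≡c-f0 = 0≤i⇒+∣i∣≡i (i≤j⇒0≤j-i (bounded 0))
  add-sub : ∀ a c → 1ℤ + c ≡ a + (1ℤ + (c - a))
  add-sub = solve-∀
  shuffle : ∀ a b → 1ℤ + (a + b) ≡ a + (1ℤ + b)
  shuffle = solve-∀
  growth : ∀ j → f 0 + + j ≤ f j
  growth zero    = ≤-reflexive (+-identityʳ (f 0))
  growth (suc j) =
    subst (_≤ f (suc j)) (shuffle (f 0) (+ j)) (i<j⇒suc[i]≤j (≤-<-trans (growth j) (increasing j)))

-- Displacements and block orders

data ℤ∞ : Set where
  -∞  : ℤ∞
  fin : ℤ → ℤ∞
  +∞  : ℤ∞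

fin-injective : ∀ {z z'} → fin z ≡ fin z' → z ≡ z'
fin-injective refl = refl

neg : ℤ∞ → ℤ∞
neg -∞      = +∞
neg (fin z) = fin (- z)
neg +∞      = -∞

infixr 6 _⊞_
_⊞_ : ℤ → ℤ∞ → ℤ∞
e ⊞ -∞    = -∞
e ⊞ fin z = fin (e + z)
e ⊞ +∞    = +∞

infix 4 _≤∞_
_≤∞_ : ℤ → ℤ∞ → Set
s ≤∞ -∞    = ⊥
s ≤∞ fin z = s ≤ z
s ≤∞ +∞    = ⊤

neg-involutive∞ : ∀ d → neg (neg d) ≡ d
neg-involutive∞ -∞      = refl
neg-involutive∞ (fin z) = cong fin (neg-involutive z)
neg-involutive∞ +∞      = refl

neg-⊞ : ∀ e d → neg (e ⊞ d) ≡ (- e) ⊞ neg d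
neg-⊞ e -∞      = refl
neg-⊞ e (fin z) = cong fin (neg-distrib-+ e z)
neg-⊞ e +∞      = refl

≤∞-trans : ∀ {s s' d} → s ≤ s' → s' ≤∞ d → s ≤∞ d
≤∞-trans {d = fin z} s≤s' s'≤z = ≤-trans s≤s' s'≤z
≤∞-trans {d = +∞}    _     _    = tt

≤∞-⊞ : ∀ {s d} e → s ≤∞ d → e + s ≤∞ e ⊞ d
≤∞-⊞ {d = fin z} e s≤z = +-monoʳ-≤ e s≤z
≤∞-⊞ {d = +∞}    e _   = tt

≤∞-⊞-nonneg : ∀ {d} e → 0ℤ ≤∞ d → e ≤∞ e ⊞ d
≤∞-⊞-nonneg {d} e 0≤d = subst (_≤∞ e ⊞ d) (+-identityʳ e) (≤∞-⊞ e 0≤d)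

≤∞-total : ∀ d → 0ℤ ≤∞ d ⊎ 0ℤ ≤∞ neg d
≤∞-total -∞      = inj₂ tt
≤∞-total (fin z) = Sum.map id neg-mono-≤ (≤-total 0ℤ z)
≤∞-total +∞      = inj₁ tt

≤∞-neg-contradiction : ∀ {s s' d} → 0ℤ < s + s' → s ≤∞ d → s' ≤∞ neg d → ⊥
≤∞-neg-contradiction {s} {s'} {fin z} 0<s+s' s≤z s'≤-z =
  <-irrefl refl (<-≤-trans 0<s+s' (subst (s + s' ≤_) (+-inverseʳ z) (+-mono-≤ s≤z s'≤-z)))

≡fin0? : ∀ d → Dec (d ≡ fin 0ℤ)
≡fin0? -∞      = no λ ()
≡fin0? (fin z) = map′ (cong fin) fin-injective (z ≟ 0ℤ)
≡fin0? +∞      = no λ ()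

0≤∞? : ∀ d → Dec (0ℤ ≤∞ d)
0≤∞? -∞      = no λ ()
0≤∞? (fin z) = 0ℤ ≤? z
0≤∞? +∞      = yes tt

τ : ℕ → ℤ
τ k = + (2 ℕ.^ k)

0<τ : ∀ k → 0ℤ < τ k
0<τ k = +<+ (ℕₚ.m^n>0 2 k)

0≤τ : ∀ k → 0ℤ ≤ τ k
0≤τ k = <⇒≤ (0<τ k)

τ-suc : ∀ k → τ (suc k) ≡ τ k + τ k
τ-suc k = trans (cong (λ m → + (2 ℕ.^ k ℕ.+ m)) (ℕₚ.+-identityʳ (2 ℕ.^ k))) (pos-+ (2 ℕ.^ k) (2 ℕ.^ k))

τ-mono : ∀ k → τ k ≤ τ (suc k)
τ-mono k = subst (τ k ≤_) (sym (τ-suc k)) (i≤j+i (τ k) (τ k))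

τ≡-τ+τ[1+k] : ∀ k → τ k ≡ - τ k + τ (suc k)
τ≡-τ+τ[1+k] k = trans (halve (τ k)) (cong (_+_ (- τ k)) (sym (τ-suc k)))
  where
  halve : ∀ t → t ≡ - t + (t + t)
  halve = solve-∀

τ≤e+τ[1+k] : ∀ {k e} → - τ k < e → τ k ≤ e + τ (suc k)
τ≤e+τ[1+k] {k} -τ<e = ≤-trans (≤-reflexive (τ≡-τ+τ[1+k] k)) (+-monoˡ-≤ (τ (suc k)) (<⇒≤ -τ<e))

infix 4 _∼⟨_⟩_
data _∼⟨_⟩_ (d : ℤ∞) (k : ℕ) (d' : ℤ∞) : Set where
  equal : d ≡ d' → d ∼⟨ k ⟩ d'
  above : τ k ≤∞ d → τ k ≤∞ d' → d ∼⟨ k ⟩ d'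
  below : τ k ≤∞ neg d → τ k ≤∞ neg d' → d ∼⟨ k ⟩ d'

∼-sym : ∀ {k d d'} → d ∼⟨ k ⟩ d' → d' ∼⟨ k ⟩ d
∼-sym (equal d≡d')     = equal (sym d≡d')
∼-sym (above τ≤d τ≤d') = above τ≤d' τ≤d
∼-sym (below τ≤d τ≤d') = below τ≤d' τ≤d

∼-neg : ∀ {k d d'} → d ∼⟨ k ⟩ d' → neg d ∼⟨ k ⟩ neg d'
∼-neg (equal d≡d') = equal (cong neg d≡d')
∼-neg {k} {d} {d'} (above τ≤d τ≤d') =
  below (subst (τ k ≤∞_) (sym (neg-involutive∞ d)) τ≤d) (subst (τ k ≤∞_) (sym (neg-involutive∞ d')) τ≤d')
∼-neg (below τ≤-d τ≤-d') = above τ≤-d τ≤-d'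

∼-mono : ∀ {k d d'} → d ∼⟨ suc k ⟩ d' → d ∼⟨ k ⟩ d'
∼-mono (equal d≡d')         = equal d≡d'
∼-mono {k} (above τ≤d τ≤d') = above (≤∞-trans (τ-mono k) τ≤d) (≤∞-trans (τ-mono k) τ≤d')
∼-mono {k} (below τ≤d τ≤d') = below (≤∞-trans (τ-mono k) τ≤d) (≤∞-trans (τ-mono k) τ≤d')

∼-preserves-≤∞ : ∀ {k s d d'} → 0ℤ ≤ s → s ≤ τ k → d ∼⟨ k ⟩ d' → s ≤∞ d → s ≤∞ d'
∼-preserves-≤∞ _ _ (equal refl) s≤d = s≤d
∼-preserves-≤∞ _ s≤τ (above _ τ≤d') _ = ≤∞-trans s≤τ τ≤d'
∼-preserves-≤∞ {k} 0≤s _ (below τ≤-d _) s≤d =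
  ⊥-elim (≤∞-neg-contradiction (+-mono-≤-< 0≤s (0<τ k)) s≤d τ≤-d)

∼-zero : ∀ {k d d'} → d ∼⟨ k ⟩ d' → d ≡ fin 0ℤ → d' ≡ fin 0ℤ
∼-zero (equal d≡d') d≡0 = trans (sym d≡d') d≡0
∼-zero {k} (above τ≤0 _) refl = ⊥-elim (<⇒≱ (0<τ k) τ≤0)
∼-zero {k} (below τ≤0 _) refl = ⊥-elim (<⇒≱ (0<τ k) τ≤0)

Short : ℕ → ℤ → Set
Short k e = - τ k < e × e < τ k

∼-shift : ∀ {k d d' e} → d ∼⟨ suc k ⟩ d' → Short k e → e ⊞ d ∼⟨ k ⟩ e ⊞ d'
∼-shift (equal refl) _ = equal refl
∼-shift {k} {e = e} (above τ≤d τ≤d') (-τ<e , _) =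
  above (≤∞-trans (τ≤e+τ[1+k] {k} -τ<e) (≤∞-⊞ e τ≤d)) (≤∞-trans (τ≤e+τ[1+k] {k} -τ<e) (≤∞-⊞ e τ≤d'))
∼-shift {k} {d} {d'} {e} (below τ≤-d τ≤-d') (_ , e<τ) = below (shifted d τ≤-d) (shifted d' τ≤-d')
  where
  shifted : ∀ x → τ (suc k) ≤∞ neg x → τ k ≤∞ neg (e ⊞ x)
  shifted x τ≤-x = subst (τ k ≤∞_) (sym (neg-⊞ e x))
    (≤∞-trans (τ≤e+τ[1+k] {k} (neg-mono-< e<τ)) (≤∞-⊞ (- e) τ≤-x))

record Near (k : ℕ) (d : ℤ∞) : Set where
  constructor near
  field
    offset   : ℤ
    d≡offset : d ≡ fin offset
    short    : Short k offset

near? : ∀ k d → Dec (Near k d)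
near? k -∞      = no λ { (near _ () _) }
near? k (fin e) = map′ (near e refl) (λ { (near _ refl short) → short }) ((- τ k <? e) ×-dec (e <? τ k))
near? k +∞      = no λ { (near _ () _) }

apart : ∀ {k} d → ¬ Near k d → τ k ≤∞ d ⊎ τ k ≤∞ neg d
apart -∞ _ = inj₂ tt
apart +∞ _ = inj₁ tt
apart {k} (fin e) far with - τ k <? e | e <? τ k
... | yes -τ<e | yes e<τ = ⊥-elim (far (near e refl (-τ<e , e<τ)))
... | yes _    | no e≮τ  = inj₁ (≮⇒≥ e≮τ)
... | no -τ≮e  | _       = inj₂ (subst (_≤ - e) (neg-involutive (τ k)) (neg-mono-≤ (≮⇒≥ -τ≮e)))

apart-above : ∀ {k d} → ¬ Near k d → 0ℤ ≤∞ d → τ k ≤∞ d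
apart-above {k} {d} far 0≤d with apart {k} d far
... | inj₁ τ≤d  = τ≤d
... | inj₂ τ≤-d = ⊥-elim (≤∞-neg-contradiction (0<τ k) 0≤d τ≤-d)

apart-below : ∀ {k d} → ¬ Near k d → ¬ 0ℤ ≤∞ d → τ k ≤∞ neg d
apart-below {k} {d} far d≱0 with apart {k} d far
... | inj₁ τ≤d  = ⊥-elim (d≱0 (≤∞-trans (0≤τ k) τ≤d))
... | inj₂ τ≤-d = τ≤-d

-- Δ a b is the offset from a to b when they lie in the same copy of ℤ, and +∞ (−∞) when the copy
-- of b lies above (below) that of a; b ⊖ e is the point e steps below b.
record BlockOrder : Set₁ where
  field
    Carrier         : Set
    _≼_             : Rel Carrier 0ℓ
    Δ               : Carrier → Carrier → ℤ∞
    _⊖_             : Carrier → ℤ → Carrier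
    point           : Carrier
    ≼⇔0≤∞Δ          : ∀ {a b} → a ≼ b ⇔ 0ℤ ≤∞ Δ a b
    Δ-refl          : ∀ a → Δ a a ≡ fin 0ℤ
    Δ≡0⇒≡           : ∀ {a b} → Δ a b ≡ fin 0ℤ → a ≡ b
    Δ-flip          : ∀ a b → Δ b a ≡ neg (Δ a b)
    Δ-⊖             : ∀ b e → Δ (b ⊖ e) b ≡ fin e
    Δ-cocycle       : ∀ {a b} c {e} → Δ a b ≡ fin e → Δ a c ≡ e ⊞ Δ b c
    Δ-superadditive : ∀ {a b c s s'} → s ≤∞ Δ a b → s' ≤∞ Δ b c → s + s' ≤∞ Δ a c

module BlockOrderProperties (X : BlockOrder) where
  open BlockOrder X
  open Equivalence

  ≼-trans : ∀ {a b c} → a ≼ b → b ≼ c → a ≼ c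
  ≼-trans a≼b b≼c = from ≼⇔0≤∞Δ (Δ-superadditive (to ≼⇔0≤∞Δ a≼b) (to ≼⇔0≤∞Δ b≼c))

  ≼-total : ∀ a b → a ≼ b ⊎ b ≼ a
  ≼-total a b = Sum.map (from ≼⇔0≤∞Δ) (from ≼⇔0≤∞Δ ∘ subst (0ℤ ≤∞_) (sym (Δ-flip a b))) (≤∞-total (Δ a b))

  _≼?_ : Decidable _≼_
  a ≼? b = map′ (from ≼⇔0≤∞Δ) (to ≼⇔0≤∞Δ) (0≤∞? (Δ a b))

  _≟ᵇ_ : DecidableEquality Carrier
  a ≟ᵇ b = map′ Δ≡0⇒≡ (λ { refl → Δ-refl a }) (≡fin0? (Δ a b))

  Δ-⊖ˡ : ∀ b c e → Δ (b ⊖ e) c ≡ e ⊞ Δ b c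
  Δ-⊖ˡ b c e = Δ-cocycle c (Δ-⊖ b e)

  Δ-⊖ʳ : ∀ a b e → Δ a (b ⊖ e) ≡ (- e) ⊞ Δ a b
  Δ-⊖ʳ a b e = begin
    Δ a (b ⊖ e)          ≡⟨ Δ-flip (b ⊖ e) a ⟩
    neg (Δ (b ⊖ e) a)    ≡⟨ cong neg (Δ-⊖ˡ b a e) ⟩
    neg (e ⊞ Δ b a)      ≡⟨ neg-⊞ e (Δ b a) ⟩
    (- e) ⊞ neg (Δ b a)  ≡⟨ cong ((- e) ⊞_) (sym (Δ-flip b a)) ⟩
    (- e) ⊞ Δ a b        ∎
    where open ≡-Reasoning

⟦_⟧ : BlockOrder → Structure
⟦ X ⟧ = record { Carrier = Carrier ; _≤_ = _≼_ ; _≟_ = _≟ᵇ_ ; _≤?_ = _≼?_ }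
  where
  open BlockOrder X
  open BlockOrderProperties X

private
  telescope : ∀ a b c → c - a ≡ (b - a) + (c - b)
  telescope = solve-∀

  minus-flip : ∀ a b → a - b ≡ - (b - a)
  minus-flip = solve-∀

  minus-minus : ∀ b e → b - (b - e) ≡ e
  minus-minus = solve-∀

ℤ-blockOrder : BlockOrder
ℤ-blockOrder = record
  { Carrier         = ℤ
  ; _≼_             = _≤_
  ; Δ               = λ a b → fin (b - a)
  ; _⊖_             = _-_
  ; point           = 0ℤ
  ; ≼⇔0≤∞Δ          = mk⇔ i≤j⇒0≤j-i 0≤i-j⇒j≤i
  ; Δ-refl          = λ a → cong fin (+-inverseʳ a)
  ; Δ≡0⇒≡           = λ {a} {b} Δab≡0 → sym (i-j≡0⇒i≡j b a (fin-injective Δab≡0))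
  ; Δ-flip          = λ a b → cong fin (minus-flip a b)
  ; Δ-⊖             = λ b e → cong fin (minus-minus b e)
  ; Δ-cocycle       = λ { {a} {b} c refl → cong fin (telescope a b c) }
  ; Δ-superadditive = λ {a} {b} {c} s≤ s'≤ → subst (_ ≤_) (sym (telescope a b c)) (+-mono-≤ s≤ s'≤)
  }

blockΔ : ℤ → ℤ → ℤ∞
blockΔ -[1+ _ ] _ = -∞
blockΔ (+ zero) z = fin z
blockΔ +[1+ _ ] _ = +∞

blockΔ-neg : ∀ d z → blockΔ (- d) (- z) ≡ neg (blockΔ d z)
blockΔ-neg -[1+ _ ] _ = refl
blockΔ-neg (+ zero) _ = refl
blockΔ-neg +[1+ _ ] _ = refl

blockΔ-⊞ : ∀ d e z → blockΔ d (e + z) ≡ e ⊞ blockΔ d z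
blockΔ-⊞ -[1+ _ ] _ _ = refl
blockΔ-⊞ (+ zero) _ _ = refl
blockΔ-⊞ +[1+ _ ] _ _ = refl

blockΔ-fin : ∀ {d z e} → blockΔ d z ≡ fin e → d ≡ 0ℤ × z ≡ e
blockΔ-fin {+ zero} refl = refl , refl

blockΔ-superadditive : ∀ {s s'} d d' z z' → s ≤∞ blockΔ d z → s' ≤∞ blockΔ d' z' →
                       s + s' ≤∞ blockΔ (d + d') (z + z')
blockΔ-superadditive (+ zero) (+ zero) _ _ s≤z s'≤z' = +-mono-≤ s≤z s'≤z'
blockΔ-superadditive (+ zero) +[1+ _ ] _ _ _ _ = tt
blockΔ-superadditive +[1+ _ ] (+ zero) _ _ _ _ = tt
blockΔ-superadditive +[1+ _ ] +[1+ _ ] _ _ _ _ = tt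

blockΔ-nonneg : ∀ d z → 0ℤ ≤∞ blockΔ d z ⇔ (0ℤ < d ⊎ (d ≡ 0ℤ × 0ℤ ≤ z))
blockΔ-nonneg -[1+ _ ] _ = mk⇔ (λ ()) (λ { (inj₁ ()) ; (inj₂ (() , _)) })
blockΔ-nonneg (+ zero) _ = mk⇔ (λ 0≤z → inj₂ (refl , 0≤z))
                               (λ { (inj₁ 0<0) → ⊥-elim (<-irrefl refl 0<0) ; (inj₂ (_ , 0≤z)) → 0≤z })
blockΔ-nonneg +[1+ _ ] _ = mk⇔ (λ _ → inj₁ (+<+ (s≤s ℕ.z≤n))) (λ _ → tt)

module LexPairs where
  Lex : Rel (ℤ × ℤ) 0ℓ
  Lex = ×-Lex _≡_ _<_ _≤_

  Δ : ℤ × ℤ → ℤ × ℤ → ℤ∞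
  Δ (p , a) (q , b) = blockΔ (q - p) (b - a)

  0<-⇒< : ∀ {p q} → 0ℤ < q - p → p < q
  0<-⇒< {p} {q} 0<q-p = subst₂ _<_ (+-identityˡ p) (sub-add p q) (+-monoˡ-< p 0<q-p)
    where
    sub-add : ∀ p q → q - p + p ≡ q
    sub-add = solve-∀

  <⇒0<- : ∀ {p q} → p < q → 0ℤ < q - p
  <⇒0<- {p} {q} p<q = subst (_< q - p) (+-inverseʳ p) (+-monoˡ-< (- p) p<q)

  Lex⇔0≤∞Δ : ∀ {v w} → Lex v w ⇔ 0ℤ ≤∞ Δ v w
  Lex⇔0≤∞Δ {p , a} {q , b} = mk⇔ to′ from′
    where
    open Equivalence (blockΔ-nonneg (q - p) (b - a))
    to′ : Lex (p , a) (q , b) → 0ℤ ≤∞ Δ (p , a) (q , b)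
    to′ (inj₁ p<q)          = from (inj₁ (<⇒0<- p<q))
    to′ (inj₂ (refl , a≤b)) = from (inj₂ (+-inverseʳ p , i≤j⇒0≤j-i a≤b))
    from′ : 0ℤ ≤∞ Δ (p , a) (q , b) → Lex (p , a) (q , b)
    from′ 0≤Δ with to 0≤Δ
    ... | inj₁ 0<q-p           = inj₁ (0<-⇒< 0<q-p)
    ... | inj₂ (q-p≡0 , 0≤b-a) = inj₂ (sym (i-j≡0⇒i≡j q p q-p≡0) , 0≤i-j⇒j≤i 0≤b-a)

  Δ≡0⇒≡ : ∀ {v w} → Δ v w ≡ fin 0ℤ → v ≡ w
  Δ≡0⇒≡ {p , a} {q , b} Δ≡0 with blockΔ-fin Δ≡0
  ... | q-p≡0 , b-a≡0 = cong₂ _,_ (sym (i-j≡0⇒i≡j q p q-p≡0)) (sym (i-j≡0⇒i≡j b a b-a≡0))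

  Δ-cocycle : ∀ {u v} w {e} → Δ u v ≡ fin e → Δ u w ≡ e ⊞ Δ v w
  Δ-cocycle {p , a} {q , b} (r , c) {e} Δuv≡e = begin
    blockΔ (r - p) (c - a)
      ≡⟨ cong₂ blockΔ (telescope p q r) (telescope a b c) ⟩
    blockΔ ((q - p) + (r - q)) ((b - a) + (c - b))
      ≡⟨ cong₂ (λ d z → blockΔ (d + (r - q)) (z + (c - b))) q-p≡0 b-a≡e ⟩
    blockΔ (0ℤ + (r - q)) (e + (c - b))
      ≡⟨ cong (λ d → blockΔ d (e + (c - b))) (+-identityˡ (r - q)) ⟩
    blockΔ (r - q) (e + (c - b))
      ≡⟨ blockΔ-⊞ (r - q) e (c - b) ⟩
    e ⊞ blockΔ (r - q) (c - b)
      ∎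
    where
    open ≡-Reasoning
    q-p≡0 : q - p ≡ 0ℤ
    q-p≡0 = proj₁ (blockΔ-fin Δuv≡e)
    b-a≡e : b - a ≡ e
    b-a≡e = proj₂ (blockΔ-fin Δuv≡e)

  Δ-superadditive : ∀ {u v w s s'} → s ≤∞ Δ u v → s' ≤∞ Δ v w → s + s' ≤∞ Δ u w
  Δ-superadditive {p , a} {q , b} {r , c} s≤ s'≤ =
    subst (_ ≤∞_) (sym (cong₂ blockΔ (telescope p q r) (telescope a b c)))
      (blockΔ-superadditive (q - p) (r - q) (b - a) (c - b) s≤ s'≤)

ℤ×ℤ-blockOrder : BlockOrder
ℤ×ℤ-blockOrder = record
  { Carrier         = ℤ × ℤ
  ; _≼_             = Lex
  ; Δ               = Δ
  ; _⊖_             = λ (q , b) e → q , b - e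
  ; point           = 0ℤ , 0ℤ
  ; ≼⇔0≤∞Δ          = Lex⇔0≤∞Δ
  ; Δ-refl          = λ (p , a) → cong₂ blockΔ (+-inverseʳ p) (+-inverseʳ a)
  ; Δ≡0⇒≡           = Δ≡0⇒≡
  ; Δ-flip          = λ (p , a) (q , b) →
                        trans (cong₂ blockΔ (minus-flip p q) (minus-flip a b)) (blockΔ-neg (q - p) (b - a))
  ; Δ-⊖             = λ (q , b) e → cong₂ blockΔ (+-inverseʳ q) (minus-minus b e)
  ; Δ-cocycle       = Δ-cocycle
  ; Δ-superadditive = λ {u} {v} {w} → Δ-superadditive {u} {v} {w}
  }
  where open LexPairs

-- Back-and-forth between sums of block orders

module _ {A : Set} (_≤ₐ_ : Rel A 0ℓ) (≤ₐ-total : ∀ a b → a ≤ₐ b ⊎ b ≤ₐ a)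
         (≤ₐ-trans : ∀ {a b c} → a ≤ₐ b → b ≤ₐ c → a ≤ₐ c) where

  ≤ₐ-refl : ∀ a → a ≤ₐ a
  ≤ₐ-refl a = reduce (≤ₐ-total a a)

  greatestSatisfying : ∀ {P : A → Set} → (∀ a → Dec (P a)) → (as : List A) →
                       All (¬_ ∘ P) as ⊎ ∃ λ a → a ∈ as × P a × (∀ {b} → b ∈ as → P b → b ≤ₐ a)
  greatestSatisfying P? [] = inj₁ []
  greatestSatisfying P? (a ∷ as) with P? a | greatestSatisfying P? as
  ... | no ¬Pa | inj₁ none = inj₁ (¬Pa ∷ none)
  ... | no ¬Pa | inj₂ (m , m∈ , Pm , max) =
    inj₂ (m , there m∈ , Pm , λ { (here refl) Pb → ⊥-elim (¬Pa Pb) ; (there b∈) Pb → max b∈ Pb })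
  ... | yes Pa | inj₁ none =
    inj₂ (a , here refl , Pa , λ { (here refl) _ → ≤ₐ-refl a ; (there b∈) Pb → ⊥-elim (lookup none b∈ Pb) })
  ... | yes Pa | inj₂ (m , m∈ , Pm , max) with ≤ₐ-total a m
  ...   | inj₁ a≤m = inj₂ (m , there m∈ , Pm , λ { (here refl) _ → a≤m ; (there b∈) Pb → max b∈ Pb })
  ...   | inj₂ m≤a =
    inj₂ (a , here refl , Pa , λ { (here refl) _ → ≤ₐ-refl a ; (there b∈) Pb → ≤ₐ-trans (max b∈ Pb) m≤a })

module Similarity (X Y : BlockOrder) where
  private
    module X = BlockOrder X
    module Y = BlockOrder Y
    module PX = BlockOrderProperties X
    module PY = BlockOrderProperties Y
  open Equivalence

  Similar : ℕ → X.Carrier × Y.Carrier → X.Carrier × Y.Carrier → Set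
  Similar k (x , y) (x' , y') = X.Δ x x' ∼⟨ k ⟩ Y.Δ y y'

  Pairwise : ℕ → List (X.Carrier × Y.Carrier) → Set
  Pairwise k ps = ∀ {p q} → p ∈ ps → q ∈ ps → Similar k p q

  Agrees : ℕ → X.Carrier × Y.Carrier → List (X.Carrier × Y.Carrier) → Set
  Agrees k p ps = ∀ {q} → q ∈ ps → Similar k p q

  Apart : ℕ → X.Carrier → List (X.Carrier × Y.Carrier) → Set
  Apart k x ps = ∀ {q} → q ∈ ps → ¬ Near k (X.Δ x (proj₁ q))

  private
    variable
      k : ℕ
      ps : List (X.Carrier × Y.Carrier)

  Similar-refl : ∀ p → Similar k p p
  Similar-refl (x , y) = equal (trans (X.Δ-refl x) (sym (Y.Δ-refl y)))

  Similar-flip : ∀ {p q} → Similar k p q → Similar k q p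
  Similar-flip {p = x , y} {x' , y'} s = subst₂ (_∼⟨ _ ⟩_) (sym (X.Δ-flip x x')) (sym (Y.Δ-flip y y')) (∼-neg s)

  Similar-≼ : ∀ {x y x' y'} → Similar k (x , y) (x' , y') → x X.≼ x' ⇔ y Y.≼ y'
  Similar-≼ {k} s = mk⇔
    (λ x≼x' → from Y.≼⇔0≤∞Δ (∼-preserves-≤∞ ≤-refl (0≤τ k) s (to X.≼⇔0≤∞Δ x≼x')))
    (λ y≼y' → from X.≼⇔0≤∞Δ (∼-preserves-≤∞ ≤-refl (0≤τ k) (∼-sym s) (to Y.≼⇔0≤∞Δ y≼y')))

  Similar-≡ : ∀ {x y x' y'} → Similar k (x , y) (x' , y') → x ≡ x' ⇔ y ≡ y'
  Similar-≡ {x = x} {y} s = mk⇔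
    (λ { refl → Y.Δ≡0⇒≡ (∼-zero s (X.Δ-refl x)) })
    (λ { refl → X.Δ≡0⇒≡ (∼-zero (∼-sym s) (Y.Δ-refl y)) })

  forth-near : ∀ {x xᵢ yᵢ e} → Agrees (suc k) (xᵢ , yᵢ) ps → X.Δ x xᵢ ≡ fin e → Short k e →
               Agrees k (x , yᵢ Y.⊖ e) ps
  forth-near {k} {x = x} {xᵢ} {yᵢ} {e} simᵢ Δxxᵢ≡e short {xⱼ , yⱼ} j∈ =
    subst₂ (_∼⟨ k ⟩_) (sym (X.Δ-cocycle xⱼ Δxxᵢ≡e)) (sym (PY.Δ-⊖ˡ yᵢ yⱼ e)) (∼-shift (simᵢ j∈) short)

  forth-above-predecessor : ∀ {x xᵢ yᵢ} → Pairwise (suc k) ps → Apart k x ps → (xᵢ , yᵢ) ∈ ps → ¬ x X.≼ xᵢ →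
                            (∀ {q} → q ∈ ps → ¬ x X.≼ proj₁ q → proj₁ q X.≼ xᵢ) →
                            Agrees k (x , yᵢ Y.⊖ (- τ k)) ps
  forth-above-predecessor {k} {x = x} {xᵢ} {yᵢ} sim far i∈ x⋠xᵢ max {xⱼ , yⱼ} j∈ with x PX.≼? xⱼ
  ... | yes x≼xⱼ = above τ≤Δxxⱼ τ≤Δyyⱼ
    where
    τ≤Δxxⱼ : τ k ≤∞ X.Δ x xⱼ
    τ≤Δxxⱼ = apart-above (far j∈) (to X.≼⇔0≤∞Δ x≼xⱼ)
    τ≤Δxᵢx : τ k ≤∞ X.Δ xᵢ x
    τ≤Δxᵢx = subst (τ k ≤∞_) (sym (X.Δ-flip x xᵢ)) (apart-below (far i∈) (x⋠xᵢ ∘ from X.≼⇔0≤∞Δ))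
    τ'≤Δxᵢxⱼ : τ (suc k) ≤∞ X.Δ xᵢ xⱼ
    τ'≤Δxᵢxⱼ = subst (_≤∞ X.Δ xᵢ xⱼ) (sym (τ-suc k)) (X.Δ-superadditive τ≤Δxᵢx τ≤Δxxⱼ)
    τ'≤Δyᵢyⱼ : τ (suc k) ≤∞ Y.Δ yᵢ yⱼ
    τ'≤Δyᵢyⱼ = ∼-preserves-≤∞ (0≤τ (suc k)) ≤-refl (sim i∈ j∈) τ'≤Δxᵢxⱼ
    τ≤Δyyⱼ : τ k ≤∞ Y.Δ (yᵢ Y.⊖ (- τ k)) yⱼ
    τ≤Δyyⱼ = subst (τ k ≤∞_) (sym (PY.Δ-⊖ˡ yᵢ yⱼ (- τ k)))
      (≤∞-trans (≤-reflexive (τ≡-τ+τ[1+k] k)) (≤∞-⊞ (- τ k) τ'≤Δyᵢyⱼ))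
  ... | no x⋠xⱼ = below (apart-below (far j∈) (x⋠xⱼ ∘ from X.≼⇔0≤∞Δ)) τ≤-Δyyⱼ
    where
    y : Y.Carrier
    y = yᵢ Y.⊖ (- τ k)
    0≤Δyⱼyᵢ : 0ℤ ≤∞ Y.Δ yⱼ yᵢ
    0≤Δyⱼyᵢ = ∼-preserves-≤∞ ≤-refl (0≤τ (suc k)) (sim j∈ i∈) (to X.≼⇔0≤∞Δ (max j∈ x⋠xⱼ))
    -Δyyⱼ≡ : neg (Y.Δ y yⱼ) ≡ τ k ⊞ Y.Δ yⱼ yᵢ
    -Δyyⱼ≡ = begin
      neg (Y.Δ y yⱼ)         ≡⟨ sym (Y.Δ-flip y yⱼ) ⟩
      Y.Δ yⱼ y               ≡⟨ PY.Δ-⊖ʳ yⱼ yᵢ (- τ k) ⟩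
      (- - τ k) ⊞ Y.Δ yⱼ yᵢ  ≡⟨ cong (_⊞ Y.Δ yⱼ yᵢ) (neg-involutive (τ k)) ⟩
      τ k ⊞ Y.Δ yⱼ yᵢ        ∎
      where open ≡-Reasoning
    τ≤-Δyyⱼ : τ k ≤∞ neg (Y.Δ y yⱼ)
    τ≤-Δyyⱼ = subst (τ k ≤∞_) (sym -Δyyⱼ≡) (≤∞-⊞-nonneg (τ k) 0≤Δyⱼyᵢ)

  forth-below-least : ∀ {x x₀ y₀} → Pairwise (suc k) ps → Apart k x ps → (x₀ , y₀) ∈ ps →
                      (∀ {q} → q ∈ ps → x₀ X.≼ proj₁ q) → (∀ {q} → q ∈ ps → x X.≼ proj₁ q) →
                      Agrees k (x , y₀ Y.⊖ τ k) ps
  forth-below-least {k} {x₀ = x₀} {y₀} sim far g∈ least x≼ {xⱼ , yⱼ} j∈ =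
    above (apart-above (far j∈) (to X.≼⇔0≤∞Δ (x≼ j∈)))
          (subst (τ k ≤∞_) (sym (PY.Δ-⊖ˡ y₀ yⱼ (τ k))) (≤∞-⊞-nonneg (τ k) 0≤Δy₀yⱼ))
    where
    0≤Δy₀yⱼ : 0ℤ ≤∞ Y.Δ y₀ yⱼ
    0≤Δy₀yⱼ = ∼-preserves-≤∞ ≤-refl (0≤τ (suc k)) (sim g∈ j∈) (to X.≼⇔0≤∞Δ (least j∈))

  forth-apart : Pairwise (suc k) ps → ∀ x → Apart k x ps → ∃ λ y → Agrees k (x , y) ps
  forth-apart {k} {ps} sim x far
    with greatestSatisfying (λ p q → proj₁ p X.≼ proj₁ q) (λ _ _ → PX.≼-total _ _) PX.≼-trans
                            (λ q → ¬? (x PX.≼? proj₁ q)) ps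
  ... | inj₂ ((xᵢ , yᵢ) , i∈ , x⋠xᵢ , max) = yᵢ Y.⊖ (- τ k) , forth-above-predecessor sim far i∈ x⋠xᵢ max
  ... | inj₁ noneBelow
    with greatestSatisfying (λ p q → proj₁ q X.≼ proj₁ p) (λ _ _ → PX.≼-total _ _) (flip PX.≼-trans)
                            (λ _ → yes tt) ps
  ...   | inj₁ empty = Y.point , λ q∈ → ⊥-elim (lookup empty q∈ tt)
  ...   | inj₂ ((x₀ , y₀) , g∈ , _ , least) =
    y₀ Y.⊖ τ k , forth-below-least sim far g∈ (λ q∈ → least q∈ tt)
                                   (λ q∈ → decidable-stable (x PX.≼? _) (lookup noneBelow q∈))

  forth : Pairwise (suc k) ps → ∀ x → ∃ λ y → Agrees k (x , y) ps
  forth {k} {ps} sim x with any? (λ q → near? k (X.Δ x (proj₁ q))) ps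
  ... | yes someNear =
    let (xᵢ , yᵢ) , i∈ , near e Δxxᵢ≡e short = find someNear
    in yᵢ Y.⊖ e , forth-near (sim i∈) Δxxᵢ≡e short
  ... | no noneNear = forth-apart sim x (λ q∈ near → noneNear (lose q∈ near))

module _ {A B : Set} where
  consLeft : A ⊎ B → List A → List A
  consLeft (inj₁ a) as = a ∷ as
  consLeft (inj₂ _) as = as

  lefts : ∀ {n} → (Fin n → A ⊎ B) → List A
  lefts {zero}  f = []
  lefts {suc n} f = consLeft (f zero) (lefts (f ∘ suc))

  ∈-lefts : ∀ {n} (f : Fin n → A ⊎ B) {i a} → f i ≡ inj₁ a → a ∈ lefts f
  ∈-lefts f {zero} fi≡a rewrite fi≡a = here refl
  ∈-lefts f {suc i} fi≡a = ∈-consLeft (f zero) (∈-lefts (f ∘ suc) fi≡a)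
    where
    ∈-consLeft : ∀ s {a as} → a ∈ as → a ∈ consLeft s as
    ∈-consLeft (inj₁ _) a∈ = there a∈
    ∈-consLeft (inj₂ _) a∈ = a∈

  lefts-∈ : ∀ {n} (f : Fin n → A ⊎ B) {a} → a ∈ lefts f → ∃ λ i → f i ≡ inj₁ a
  lefts-∈ {suc n} f a∈ with f zero in f0≡
  lefts-∈ {suc n} f (here refl) | inj₁ _ = zero , f0≡
  lefts-∈ {suc n} f (there a∈)  | inj₁ _ = Product.map suc id (lefts-∈ (f ∘ suc) a∈)
  lefts-∈ {suc n} f a∈          | inj₂ _ = Product.map suc id (lefts-∈ (f ∘ suc) a∈)

rights : ∀ {A B : Set} {n} → (Fin n → A ⊎ B) → List B
rights f = lefts (Sum.swap ∘ f)

module _ {A B : Set} where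
  ∈-rights : ∀ {n} (f : Fin n → A ⊎ B) {i b} → f i ≡ inj₂ b → b ∈ rights f
  ∈-rights f fi≡b = ∈-lefts (Sum.swap ∘ f) (cong Sum.swap fi≡b)

  rights-∈ : ∀ {n} (f : Fin n → A ⊎ B) {b} → b ∈ rights f → ∃ λ i → f i ≡ inj₂ b
  rights-∈ f b∈ = Product.map₂ (λ swap-fi≡b → trans (sym (swap-involutive _)) (cong Sum.swap swap-fi≡b))
                              (lefts-∈ (Sum.swap ∘ f) b∈)

module SumGame (X₁ X₂ Y₁ Y₂ : BlockOrder) where
  private
    module X₁ = BlockOrder X₁
    module X₂ = BlockOrder X₂
    module Y₁ = BlockOrder Y₁
    module Y₂ = BlockOrder Y₂
    module S₁ = Similarity X₁ Y₁
    module S₂ = Similarity X₂ Y₂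
  open Equivalence

  A B : Structure
  A = ⟦ X₁ ⟧ ⊕ ⟦ X₂ ⟧
  B = ⟦ Y₁ ⟧ ⊕ ⟦ Y₂ ⟧

  Pair : Set
  Pair = (X₁.Carrier × Y₁.Carrier) ⊎ (X₂.Carrier × Y₂.Carrier)

  left : Pair → ∣ A ∣
  left = Sum.map proj₁ proj₁

  right : Pair → ∣ B ∣
  right = Sum.map proj₂ proj₂

  Compatible : ℕ → Pair → Pair → Set
  Compatible k (inj₁ p) (inj₁ q) = S₁.Similar k p q
  Compatible k (inj₂ p) (inj₂ q) = S₂.Similar k p q
  Compatible k _        _        = ⊤

  private
    variable
      k n : ℕ

  Compatible-mono : ∀ p q → Compatible (suc k) p q → Compatible k p q
  Compatible-mono (inj₁ _) (inj₁ _) = ∼-mono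
  Compatible-mono (inj₁ _) (inj₂ _) = λ _ → tt
  Compatible-mono (inj₂ _) (inj₁ _) = λ _ → tt
  Compatible-mono (inj₂ _) (inj₂ _) = ∼-mono

  Compatible-refl : ∀ p → Compatible k p p
  Compatible-refl (inj₁ p) = S₁.Similar-refl p
  Compatible-refl (inj₂ p) = S₂.Similar-refl p

  Compatible-flip : ∀ p q → Compatible k p q → Compatible k q p
  Compatible-flip (inj₁ _) (inj₁ _) = S₁.Similar-flip
  Compatible-flip (inj₁ _) (inj₂ _) = λ _ → tt
  Compatible-flip (inj₂ _) (inj₁ _) = λ _ → tt
  Compatible-flip (inj₂ _) (inj₂ _) = S₂.Similar-flip

  Compatible-≤ : ∀ p q → Compatible k p q → A ⊢ left p ≤ left q ⇔ B ⊢ right p ≤ right q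
  Compatible-≤ (inj₁ _) (inj₁ _) s = mk⇔ (λ { (inj₁ x≼x') → inj₁ (to (S₁.Similar-≼ s) x≼x') })
                                          (λ { (inj₁ y≼y') → inj₁ (from (S₁.Similar-≼ s) y≼y') })
  Compatible-≤ (inj₁ _) (inj₂ _) _ = mk⇔ (λ ()) (λ ())
  Compatible-≤ (inj₂ _) (inj₁ _) _ = mk⇔ (λ ()) (λ ())
  Compatible-≤ (inj₂ _) (inj₂ _) s = mk⇔ (λ { (inj₂ x≼x') → inj₂ (to (S₂.Similar-≼ s) x≼x') })
                                          (λ { (inj₂ y≼y') → inj₂ (from (S₂.Similar-≼ s) y≼y') })

  Compatible-≡ : ∀ p q → Compatible k p q → left p ≡ left q ⇔ right p ≡ right q
  Compatible-≡ (inj₁ _) (inj₁ _) s = mk⇔ (cong inj₁ ∘ to (S₁.Similar-≡ s) ∘ inj₁-injective)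
                                          (cong inj₁ ∘ from (S₁.Similar-≡ s) ∘ inj₁-injective)
  Compatible-≡ (inj₁ _) (inj₂ _) _ = mk⇔ (λ ()) (λ ())
  Compatible-≡ (inj₂ _) (inj₁ _) _ = mk⇔ (λ ()) (λ ())
  Compatible-≡ (inj₂ _) (inj₂ _) s = mk⇔ (cong inj₂ ∘ to (S₂.Similar-≡ s) ∘ inj₂-injective)
                                          (cong inj₂ ∘ from (S₂.Similar-≡ s) ∘ inj₂-injective)

  record Related (k : ℕ) {n} (ρ : Fin n → ∣ A ∣) (σ : Fin n → ∣ B ∣) : Set where
    field
      pairs      : Fin n → Pair
      ρ≡left     : ∀ i → ρ i ≡ left (pairs i)
      σ≡right    : ∀ i → σ i ≡ right (pairs i)
      compatible : ∀ i j → Compatible k (pairs i) (pairs j)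
  open Related

  atomic-≤ : ∀ {ρ σ} → Related k {n} ρ σ → ∀ i j → A ⊢ ρ i ≤ ρ j ⇔ B ⊢ σ i ≤ σ j
  atomic-≤ R i j rewrite ρ≡left R i | ρ≡left R j | σ≡right R i | σ≡right R j =
    Compatible-≤ (pairs R i) (pairs R j) (compatible R i j)

  atomic-≡ : ∀ {ρ σ} → Related k {n} ρ σ → ∀ i j → ρ i ≡ ρ j ⇔ σ i ≡ σ j
  atomic-≡ R i j rewrite ρ≡left R i | ρ≡left R j | σ≡right R i | σ≡right R j =
    Compatible-≡ (pairs R i) (pairs R j) (compatible R i j)

  start : ∀ k → Related k noVars noVars
  start k = record { pairs = noVars ; ρ≡left = λ () ; σ≡right = λ () ; compatible = λ () }

  extend-Related : ∀ {ρ σ} (R : Related (suc k) {n} ρ σ) π → (∀ j → Compatible k π (pairs R j)) →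
                   Related k (extend (left π) ρ) (extend (right π) σ)
  extend-Related R π π-compatible = record
    { pairs      = extend π (pairs R)
    ; ρ≡left     = λ { zero → refl ; (suc i) → ρ≡left R i }
    ; σ≡right    = λ { zero → refl ; (suc i) → σ≡right R i }
    ; compatible = λ where
        zero    zero    → Compatible-refl π
        zero    (suc j) → π-compatible j
        (suc i) zero    → Compatible-flip π (pairs R i) (π-compatible i)
        (suc i) (suc j) → Compatible-mono (pairs R i) (pairs R j) (compatible R i j)
    }

  forth : ∀ {ρ σ} → Related (suc k) {n} ρ σ → ∀ a → ∃ λ b → Related k (extend a ρ) (extend b σ)
  forth {k} R (inj₁ x) =
    let y , agrees = S₁.forth pairwise x
    in inj₁ y , extend-Related R (inj₁ (x , y)) (λ j → toward (pairs R j) (agrees ∘ ∈-lefts (pairs R)))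
    where
    pairwise : S₁.Pairwise (suc k) (lefts (pairs R))
    pairwise p∈ q∈ with lefts-∈ (pairs R) p∈ | lefts-∈ (pairs R) q∈
    ... | i , pᵢ≡p | j , pⱼ≡q = subst₂ (Compatible (suc k)) pᵢ≡p pⱼ≡q (compatible R i j)
    toward : ∀ {p} π → (∀ {q} → π ≡ inj₁ q → S₁.Similar k p q) → Compatible k (inj₁ p) π
    toward (inj₁ q) similar = similar refl
    toward (inj₂ _) _       = tt
  forth {k} R (inj₂ x) =
    let y , agrees = S₂.forth pairwise x
    in inj₂ y , extend-Related R (inj₂ (x , y)) (λ j → toward (pairs R j) (agrees ∘ ∈-rights (pairs R)))
    where
    pairwise : S₂.Pairwise (suc k) (rights (pairs R))
    pairwise p∈ q∈ with rights-∈ (pairs R) p∈ | rights-∈ (pairs R) q∈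
    ... | i , pᵢ≡p | j , pⱼ≡q = subst₂ (Compatible (suc k)) pᵢ≡p pⱼ≡q (compatible R i j)
    toward : ∀ {p} π → (∀ {q} → π ≡ inj₂ q → S₂.Similar k p q) → Compatible k (inj₂ p) π
    toward (inj₁ _) _       = tt
    toward (inj₂ q) similar = similar refl

module _ (X₁ X₂ Y₁ Y₂ : BlockOrder) where
  private
    module G  = SumGame X₁ X₂ Y₁ Y₂
    module G′ = SumGame Y₁ Y₂ X₁ X₂

  swapPair : G.Pair → G′.Pair
  swapPair = Sum.map Product.swap Product.swap

  Compatible-swap : ∀ {k} p q → G.Compatible k p q → G′.Compatible k (swapPair p) (swapPair q)
  Compatible-swap (inj₁ _) (inj₁ _) = ∼-sym
  Compatible-swap (inj₁ _) (inj₂ _) = λ _ → tt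
  Compatible-swap (inj₂ _) (inj₁ _) = λ _ → tt
  Compatible-swap (inj₂ _) (inj₂ _) = ∼-sym

  Related-swap : ∀ {k n ρ σ} → G.Related k {n} ρ σ → G′.Related k σ ρ
  Related-swap R = record
    { pairs      = swapPair ∘ pairs
    ; ρ≡left     = λ i → trans (σ≡right i) (right≡left′ (pairs i))
    ; σ≡right    = λ i → trans (ρ≡left i) (left≡right′ (pairs i))
    ; compatible = λ i j → Compatible-swap (pairs i) (pairs j) (compatible i j)
    }
    where
    open G.Related R
    right≡left′ : ∀ p → G.right p ≡ G′.left (swapPair p)
    right≡left′ (inj₁ _) = refl
    right≡left′ (inj₂ _) = refl
    left≡right′ : ∀ p → G.left p ≡ G′.right (swapPair p)
    left≡right′ (inj₁ _) = refl
    left≡right′ (inj₂ _) = refl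

blockSums-backAndForth : (X₁ X₂ Y₁ Y₂ : BlockOrder) → BackAndForth (⟦ X₁ ⟧ ⊕ ⟦ X₂ ⟧) (⟦ Y₁ ⟧ ⊕ ⟦ Y₂ ⟧)
blockSums-backAndForth X₁ X₂ Y₁ Y₂ = record
  { Related  = G.Related
  ; atomic-≤ = G.atomic-≤
  ; atomic-≡ = G.atomic-≡
  ; forth    = G.forth
  ; back     = λ R b → let a , R′ = G′.forth (Related-swap X₁ X₂ Y₁ Y₂ R) b in a , Related-swap Y₁ Y₂ X₁ X₂ R′
  ; start    = G.start
  }
  where
  module G  = SumGame X₁ X₂ Y₁ Y₂
  module G′ = SumGame Y₁ Y₂ X₁ X₂

-- The separating pair

M N : Structure
M = ⟦ ℤ-blockOrder ⟧ ⊕ ⟦ ℤ-blockOrder ⟧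
N = ⟦ ℤ-blockOrder ⟧ ⊕ ⟦ ℤ×ℤ-blockOrder ⟧

M-isAssociativePoset : IsAssociativePoset M
M-isAssociativePoset = ⊕-self-isAssociativePoset ⟦ ℤ-blockOrder ⟧ ≤-isTotalOrder

N-notAssociativePoset : ¬ IsAssociativePoset N
N-notAssociativePoset (_ , _·_ , rrb , adm) = no-bounded-increasing f f-increasing c f≤c
  where
  open AdmissibleRRB N _·_ rrb adm

  a b u v : ∣ N ∣
  a = inj₁ 0ℤ
  b = inj₂ (0ℤ , 0ℤ)
  u = a · b
  v = b · a

  u-in-ℤ×ℤ : ∃ λ w → u ≡ inj₂ w × ⟦ ℤ×ℤ-blockOrder ⟧ ⊢ w ≤ (0ℤ , 0ℤ)
  u-in-ℤ×ℤ = Pointwise-inj₂ʳ (x·y≤y a b)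

  v-in-ℤ : ∃ λ c → v ≡ inj₁ c × c ≤ 0ℤ
  v-in-ℤ = Pointwise-inj₁ʳ (x·y≤y b a)

  p c : ℤ
  p = proj₁ (proj₁ u-in-ℤ×ℤ)
  c = proj₁ v-in-ℤ

  xs : ℕ → ∣ N ∣
  xs j = inj₂ (pred p , + j)

  xs≤u : ∀ j → N ⊢ xs j ≤ u
  xs≤u j = subst (N ⊢ xs j ≤_) (sym (proj₁ (proj₂ u-in-ℤ×ℤ))) (inj₂ (inj₁ (i≤pred[j]⇒i<j ≤-refl)))

  xs-strict : ∀ j → ¬ N ⊢ xs (suc j) ≤ xs j
  xs-strict j (inj₂ (inj₁ p-1<p-1))         = <-irrefl refl p-1<p-1
  xs-strict j (inj₂ (inj₂ (_ , +≤+ 1+j≤j))) = ℕₚ.1+n≰n 1+j≤j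

  image : ∀ j → ∃ λ z → xs j · v ≡ inj₁ z × z ≤ c
  image j = Pointwise-inj₁ʳ (subst (N ⊢ xs j · v ≤_) (proj₁ (proj₂ v-in-ℤ)) (x·y≤y (xs j) v))

  f : ℕ → ℤ
  f j = proj₁ (image j)

  f≤c : ∀ j → f j ≤ c
  f≤c j = proj₂ (proj₂ (image j))

  f-increasing : ∀ j → f j < f (suc j)
  f-increasing j = ≰⇒> λ f[1+j]≤f[j] → xs-strict j
    (·-reflects-≤ (y·x·x·y≡x·y a b) (xs≤u (suc j)) (xs≤u j)
      (subst₂ (N ⊢_≤_) (sym (proj₁ (proj₂ (image (suc j))))) (sym (proj₁ (proj₂ (image j))))
              (inj₁ f[1+j]≤f[j])))

corollary4p5 : ¬ Axiomatizable IsAssociativePoset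
corollary4p5 = ⊨-transfer⇒¬Axiomatizable M-isAssociativePoset N-notAssociativePoset
  (⊨-transfer (blockSums-backAndForth ℤ-blockOrder ℤ-blockOrder ℤ-blockOrder ℤ×ℤ-blockOrder))
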